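{- For $k \ge 1$ and $n \ge k+3$, $$|\mathscr{B}(n,k)| = \sum_{r=2}^{2k} |\mathscr{B}(n,k,r)|.$$
   Context: All lattices are finite. Reducible element: join-reducible ($x=y\vee z$, $y,z\ne x$) or meet-reducible ($x = y\wedge z$, $y,z\ne x$). Nullity of a finite poset: $m-n+c$ for its cover graph ($m$ covering pairs, $n$ elements, $c$ components). Block: finite lattice whose greatest element is join-reducible and least element is meet-reducible. $\mathscr{B}(n,k)$: the set of isomorphism classes of blocks on $n \ge 4$ elements, of nullity $k \ge 1$, whose reducible elements are pairwise comparable; $\mathscr{B}(n,k,r)$: the subset of those with exactly $r$ reducible elements. -}

module Defs where

open import Data.Bool using (Bool; true; false; _∧_; _∨_; not; T)
open import Data.Nat using (ℕ; zero; suc; _+_)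
open import Data.Fin using (Fin; _≟_)
open import Data.List using (List; length; filterᵇ; allFin; map)
open import Data.Bool.ListAction using (all; any)
open import Data.Nat.ListAction using (sum)
open import Data.Product using (Σ; ∃; _×_)
open import Relation.Nullary.Decidable using (⌊_⌋)
open import Relation.Binary.PropositionalEquality using (_≡_)
open import Function.Bundles using (_↔_; Inverse)

-- A binary relation on the carrier Fin n, given as a Boolean matrix
-- (intended reading: R x y = true  iff  x ≤ y).
Rel : ℕ → Set
Rel n = Fin n → Fin n → Bool

module _ {n : ℕ} where

  ∀ᶠ : (Fin n → Bool) → Bool
  ∀ᶠ p = all p (allFin n)

  ∃ᶠ : (Fin n → Bool) → Bool
  ∃ᶠ p = any p (allFin n)

  _==_ : Fin n → Fin n → Bool
  x == y = ⌊ x ≟ y ⌋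

  _⇒_ : Bool → Bool → Bool
  a ⇒ b = not a ∨ b

  isPartialOrder : Rel n → Bool
  isPartialOrder R =
    ∀ᶠ (λ x → R x x) ∧
    ∀ᶠ (λ x → ∀ᶠ (λ y → (R x y ∧ R y x) ⇒ (x == y))) ∧
    ∀ᶠ (λ x → ∀ᶠ (λ y → ∀ᶠ (λ z → (R x y ∧ R y z) ⇒ R x z)))

  isJoin : Rel n → Fin n → Fin n → Fin n → Bool
  isJoin R x y z = R y x ∧ R z x ∧ ∀ᶠ (λ u → (R y u ∧ R z u) ⇒ R x u)

  isMeet : Rel n → Fin n → Fin n → Fin n → Bool
  isMeet R x y z = isJoin (λ a b → R b a) x y z

  isLattice : Rel n → Bool
  isLattice R = isPartialOrder R ∧
    ∀ᶠ (λ y → ∀ᶠ (λ z → ∃ᶠ (λ x → isJoin R x y z) ∧ ∃ᶠ (λ x → isMeet R x y z)))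

  joinReducible : Rel n → Fin n → Bool
  joinReducible R x = ∃ᶠ (λ y → ∃ᶠ (λ z →
    not (y == x) ∧ not (z == x) ∧ isJoin R x y z))

  meetReducible : Rel n → Fin n → Bool
  meetReducible R x = ∃ᶠ (λ y → ∃ᶠ (λ z →
    not (y == x) ∧ not (z == x) ∧ isMeet R x y z))

  reducible : Rel n → Fin n → Bool
  reducible R x = joinReducible R x ∨ meetReducible R x

  count : (Fin n → Bool) → ℕ
  count p = length (filterᵇ p (allFin n))

  numReducible : Rel n → ℕ
  numReducible R = count (reducible R)

  isGreatest : Rel n → Fin n → Bool
  isGreatest R t = ∀ᶠ (λ u → R u t)

  isLeast : Rel n → Fin n → Bool
  isLeast R b = ∀ᶠ (λ u → R b u)

  isBlock : Rel n → Bool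
  isBlock R = isLattice R ∧
    ∀ᶠ (λ t → isGreatest R t ⇒ joinReducible R t) ∧
    ∀ᶠ (λ b → isLeast R b ⇒ meetReducible R b)

  reduciblesComparable : Rel n → Bool
  reduciblesComparable R = ∀ᶠ (λ x → ∀ᶠ (λ y →
    (reducible R x ∧ reducible R y) ⇒ (R x y ∨ R y x)))

  _<[_]_ : Fin n → Rel n → Fin n → Bool
  x <[ R ] y = R x y ∧ not (x == y)

  covers : Rel n → Fin n → Fin n → Bool
  covers R x y = (x <[ R ] y) ∧ not (∃ᶠ (λ z → (x <[ R ] z) ∧ (z <[ R ] y)))

  numCovers : Rel n → ℕ
  numCovers R = sum (map (λ x → count (covers R x)) (allFin n))

  -- Nullity of the cover graph is m - n + c.  For a (nonempty) lattice the
  -- cover graph is connected (every element is linked to the least element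
  -- by a chain of covers), so c = 1 and "nullity = k" means m + 1 = n + k.
  hasNullity : Rel n → ℕ → Set
  hasNullity R k = numCovers R + 1 ≡ n + k

  InB : ℕ → Rel n → Set
  InB k R = T (isBlock R ∧ reduciblesComparable R) × hasNullity R k

  InBr : ℕ → ℕ → Rel n → Set
  InBr k r R = InB k R × numReducible R ≡ r

  Iso : Rel n → Rel n → Set
  Iso R S = Σ (Fin n ↔ Fin n) λ f →
    ∀ x y → R x y ≡ S (Inverse.to f x) (Inverse.to f y)

  -- "the property P (isomorphism invariant) has exactly N isomorphism classes":
  -- a system of N pairwise non-isomorphic representatives covering all of P.
  NumIsoClasses : (Rel n → Set) → ℕ → Set
  NumIsoClasses P N = Σ (Fin N → Rel n) λ rep →
    (∀ i → P (rep i)) ×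
    (∀ i j → Iso (rep i) (rep j) → i ≡ j) ×
    (∀ R → P R → ∃ λ i → Iso R (rep i))

-- A block of nullity k has between 2 and 2k reducible elements, and the number of
-- reducible elements is an isomorphism invariant, so the isomorphism classes of
-- 𝓑(n,k) are the disjoint union of those of 𝓑(n,k,r) for 2 ≤ r ≤ 2k.
-- The top is join-reducible and the bottom meet-reducible, whence r ≥ 2.  For the
-- upper bound count the m covering pairs by their lower element: every element
-- except the top has an upper cover, and a meet-reducible x = y ∧ z has two
-- distinct ones, one below y and one below z (a common one would lie below
-- y ∧ z = x).  Hence n − 1 + #(meet-reducibles) ≤ m = n + k − 1, and dually for
-- join-reducibles.

{-# OPTIONS --safe #-}
module Submission where

open import Defs
open import Data.Nat using (ℕ; _+_; _*_; _∸_; _≤_)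
open import Data.List using (applyUpTo)
open import Data.Nat.ListAction using (sum)
open import Relation.Binary.PropositionalEquality using (_≡_)

open import Data.Nat.Properties
  using (+-0-commutativeMonoid; ≤-refl; ≤-trans; ≤-reflexive; +-comm; +-identityʳ; +-mono-≤; +-monoʳ-≤;
         m≤m+n; m≤n+m; +-cancelˡ-≤; +-cancelˡ-≡; m+[n∸m]≡n; module ≤-Reasoning)
open import Algebra.Properties.CommutativeMonoid.Sum +-0-commutativeMonoid
  using (sum-syntax; ∑-distrib-+; ∑-comm; ∑-permute; sum-remove; sum-cong-≗; sum-replicate-zero)
open import Data.Bool using (Bool; true; false; _∧_; _∨_; not; T)
open import Data.Bool.Properties using (T-∧; T-∨; T-≡; T?; ⇔→≡)
open import Data.Fin using (Fin; zero; suc; _≟_; toℕ; fromℕ<; punchIn; punchOut)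
open import Data.Fin.Induction using (po-wellFounded)
open import Data.Fin.Permutation using (↔⇒≡)
open import Data.Fin.Properties
  using (punchIn-punchOut; punchInᵢ≢i; toℕ-fromℕ<; toℕ-injective; +↔⊎; ∃-here; ∃-there; ∃-toSum)
open import Data.List using ([]; _∷_; length; filterᵇ; map; tabulate; allFin)
open import Data.List.Properties using (map-tabulate)
open import Data.List.Membership.Propositional using (lose)
open import Data.List.Membership.Propositional.Properties using (∈-allFin)
open import Data.List.Relation.Unary.All as All using (All; []; _∷_)
open import Data.List.Relation.Unary.All.Properties using (all⁺; all⁻)
import Data.List.Relation.Unary.Any as Any
open import Data.List.Relation.Unary.Any.Properties using (any⁺; any⁻)
open import Data.Nat using (zero; suc; _<_; z≤n; s≤s)
open import Data.Product using (Σ; ∃; ∃₂; _×_; _,_; proj₁; proj₂; map₂; uncurry)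
open import Data.Sum using (_⊎_; inj₁; inj₂; [_,_])
open import Data.Sum.Function.Propositional using (_⊎-↔_)
open import Function using (_∘_; flip; _⇔_; mk⇔; Equivalence; Inverse; _↔_; mk↔ₛ′)
open import Function.Construct.Composition using (_↔-∘_)
open import Function.Construct.Identity using (↔-id)
open import Function.Construct.Symmetry using (↔-sym; ⇔-sym)
open import Induction.WellFounded using (Acc; acc)
open import Relation.Binary using (IsPartialOrder; Transitive)
import Relation.Binary.Construct.Flip.EqAndOrd as Flip
import Relation.Binary.Construct.NonStrictToStrict as ToStrict
open import Relation.Binary.PropositionalEquality
  using (_≢_; refl; sym; trans; cong; cong₂; subst; subst₂; isEquivalence; module ≡-Reasoning)
open import Relation.Nullary using (¬_; yes; no; contradiction)

open Equivalence using (to; from)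

T-not : ∀ {a} → T (not a) ⇔ (¬ T a)
T-not {false} = mk⇔ (λ _ ()) _
T-not {true}  = mk⇔ (λ ()) (λ ¬t → ¬t _)

T-⇒ : ∀ {a b} → T (not a ∨ b) ⇔ (T a → T b)
T-⇒ {false} = mk⇔ (λ _ ()) _
T-⇒ {true}  = mk⇔ (λ b _ → b) (λ f → f _)

T-⇔→≡ : ∀ {a b} → T a ⇔ T b → a ≡ b
T-⇔→≡ eq = ⇔→≡ {z = true} (mk⇔ (to T-≡ ∘ to eq ∘ from T-≡) (to T-≡ ∘ from eq ∘ from T-≡))

module _ {n : ℕ} where

  T-== : {x y : Fin n} → T (x == y) ⇔ x ≡ y
  T-== {x} {y} with x ≟ y
  ... | yes x≡y = mk⇔ (λ _ → x≡y) _
  ... | no x≢y  = mk⇔ (λ ()) x≢y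

  T-∀ᶠ : {p : Fin n → Bool} → T (∀ᶠ p) ⇔ (∀ x → T (p x))
  T-∀ᶠ {p} = mk⇔
    (λ h x → All.lookup (all⁺ p (allFin n) h) (∈-allFin x))
    (λ h → all⁻ p {allFin n} (All.tabulate λ {x} _ → h x))

  T-∃ᶠ : {p : Fin n → Bool} → T (∃ᶠ p) ⇔ ∃ λ x → T (p x)
  T-∃ᶠ {p} = mk⇔
    (λ h → Any.satisfied (any⁻ p (allFin n) h))
    (λ (x , px) → any⁺ p (lose (∈-allFin x) px))

indicator : Bool → ℕ
indicator true  = 1
indicator false = 0

indicator-T : ∀ {a} → T a → indicator a ≡ 1
indicator-T {true} _ = refl

indicator-¬T : ∀ {a} → ¬ T a → indicator a ≡ 0
indicator-¬T {false} _ = refl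
indicator-¬T {true}  ¬t with () ← ¬t _

indicator-∨ : ∀ a b → indicator (a ∨ b) ≤ indicator a + indicator b
indicator-∨ true  _ = s≤s z≤n
indicator-∨ false _ = ≤-refl

length-filterᵇ : ∀ {A : Set} (p : A → Bool) xs → length (filterᵇ p xs) ≡ sum (map (indicator ∘ p) xs)
length-filterᵇ p []       = refl
length-filterᵇ p (x ∷ xs) with p x
... | true  = cong suc (length-filterᵇ p xs)
... | false = length-filterᵇ p xs

sum-tabulate : ∀ {m} (f : Fin m → ℕ) → sum (tabulate f) ≡ ∑[ i < m ] f i
sum-tabulate {zero}  f = refl
sum-tabulate {suc m} f = cong (f zero +_) (sum-tabulate (f ∘ suc))

sum-map-allFin : ∀ {m} (f : Fin m → ℕ) → sum (map f (allFin m)) ≡ ∑[ i < m ] f i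
sum-map-allFin {m} f = trans (cong sum (map-tabulate {n = m} (λ i → i) f)) (sum-tabulate f)

∑-mono-≤ : ∀ {m} {f g : Fin m → ℕ} → (∀ i → f i ≤ g i) → ∑[ i < m ] f i ≤ ∑[ i < m ] g i
∑-mono-≤ {zero}  _   = z≤n
∑-mono-≤ {suc m} f≤g = +-mono-≤ (f≤g zero) (∑-mono-≤ (f≤g ∘ suc))

∑-const-1 : ∀ m → ∑[ i < m ] 1 ≡ m
∑-const-1 zero    = refl
∑-const-1 (suc m) = cong suc (∑-const-1 m)

term≤∑ : ∀ {m} (f : Fin m → ℕ) i → f i ≤ ∑[ j < m ] f j
term≤∑ {suc m} f i = ≤-trans (m≤m+n (f i) _) (≤-reflexive (sym (sum-remove {i = i} f)))

∑-pair : ∀ {m} (f : Fin m → ℕ) {a b} → a ≢ b → f a + f b ≤ ∑[ i < m ] f i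
∑-pair {suc m} f {a} {b} a≢b = begin
  f a + f b                              ≡⟨ cong (λ j → f a + f j) (punchIn-punchOut a≢b) ⟨
  f a + f (punchIn a (punchOut a≢b))     ≤⟨ +-monoʳ-≤ (f a) (term≤∑ (f ∘ punchIn a) (punchOut a≢b)) ⟩
  f a + ∑[ j < m ] f (punchIn a j)       ≡⟨ sum-remove {i = a} f ⟨
  ∑[ i < suc m ] f i                     ∎
  where open ≤-Reasoning

∑-point : ∀ {m} (f : Fin m → ℕ) a → (∀ i → i ≢ a → f i ≡ 0) → ∑[ i < m ] f i ≡ f a
∑-point {suc m} f a vanish = begin
  ∑[ i < suc m ] f i                 ≡⟨ sum-remove {i = a} f ⟩
  f a + ∑[ j < m ] f (punchIn a j)   ≡⟨ cong (f a +_) (sum-cong-≗ (λ j → vanish (punchIn a j) (punchInᵢ≢i a j))) ⟩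
  f a + ∑[ j < m ] 0                 ≡⟨ cong (f a +_) (sum-replicate-zero m) ⟩
  f a + 0                            ≡⟨ +-identityʳ (f a) ⟩
  f a                                ∎
  where open ≡-Reasoning

module _ {n : ℕ} where

  count≡∑ : (p : Fin n → Bool) → count p ≡ ∑[ x < n ] indicator (p x)
  count≡∑ p = trans (length-filterᵇ p (allFin n)) (sum-map-allFin (indicator ∘ p))

  count-∨ : (p q : Fin n → Bool) → count (λ x → p x ∨ q x) ≤ count p + count q
  count-∨ p q = begin
    count (λ x → p x ∨ q x)                                  ≡⟨ count≡∑ _ ⟩
    ∑[ x < n ] indicator (p x ∨ q x)                         ≤⟨ ∑-mono-≤ (λ x → indicator-∨ (p x) (q x)) ⟩
    ∑[ x < n ] (indicator (p x) + indicator (q x))           ≡⟨ ∑-distrib-+ (indicator ∘ p) (indicator ∘ q) ⟩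
    ∑[ x < n ] indicator (p x) + ∑[ x < n ] indicator (q x)  ≡⟨ cong₂ _+_ (count≡∑ p) (count≡∑ q) ⟨
    count p + count q                                        ∎
    where open ≤-Reasoning

  count-witness : {p : Fin n → Bool} {a : Fin n} → T (p a) → 1 ≤ count p
  count-witness {p} {a} pa = subst₂ _≤_ (indicator-T pa) (sym (count≡∑ p)) (term≤∑ (indicator ∘ p) a)

  count-pair : {p : Fin n → Bool} {a b : Fin n} → T (p a) → T (p b) → a ≢ b → 2 ≤ count p
  count-pair {p} {a} {b} pa pb a≢b = begin
    2                                        ≡⟨ cong₂ _+_ (indicator-T pa) (indicator-T pb) ⟨
    indicator (p a) + indicator (p b)        ≤⟨ ∑-pair (indicator ∘ p) a≢b ⟩
    ∑[ x < n ] indicator (p x)               ≡⟨ count≡∑ p ⟨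
    count p                                  ∎
    where open ≤-Reasoning

  count-== : (a : Fin n) → count (_== a) ≡ 1
  count-== a = begin
    count (_== a)                    ≡⟨ count≡∑ (_== a) ⟩
    ∑[ x < n ] indicator (x == a)    ≡⟨ ∑-point _ a (λ x x≢a → indicator-¬T (x≢a ∘ to T-==)) ⟩
    indicator (a == a)               ≡⟨ indicator-T (from T-== refl) ⟩
    1                                ∎
    where open ≡-Reasoning

  count-permute : (π : Fin n ↔ Fin n) {p q : Fin n → Bool} →
                  (∀ x → p x ≡ q (Inverse.to π x)) → count p ≡ count q
  count-permute π {p} {q} p≡q∘π = begin
    count p                                         ≡⟨ count≡∑ p ⟩
    ∑[ x < n ] indicator (p x)                      ≡⟨ sum-cong-≗ (cong indicator ∘ p≡q∘π) ⟩
    ∑[ x < n ] indicator (q (Inverse.to π x))       ≡⟨ ∑-permute (indicator ∘ q) π ⟨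
    ∑[ x < n ] indicator (q x)                      ≡⟨ count≡∑ q ⟨
    count q                                         ∎
    where open ≡-Reasoning

-- Partial orders and lattices given by Boolean matrices

module _ {n : ℕ} where

  ⟦_⟧ : Rel n → Fin n → Fin n → Set
  ⟦ R ⟧ x y = T (R x y)

  module _ (R : Rel n) where

    _⊏_ : Fin n → Fin n → Set
    _⊏_ = ToStrict._<_ _≡_ ⟦ R ⟧

    IsJoin : Fin n → Fin n → Fin n → Set
    IsJoin x y z = ⟦ R ⟧ y x × ⟦ R ⟧ z x × (∀ u → ⟦ R ⟧ y u → ⟦ R ⟧ z u → ⟦ R ⟧ x u)

    T-isPartialOrder : T (isPartialOrder R) → IsPartialOrder _≡_ ⟦ R ⟧
    T-isPartialOrder h =
      let (reflexive , laws)           = to (T-∧ {∀ᶠ λ x → R x x}) h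
          (antisymmetric , transitive) = to (T-∧ {∀ᶠ λ x → ∀ᶠ λ y → not (R x y ∧ R y x) ∨ (x == y)}) laws
      in record
        { isPreorder = record
          { isEquivalence = isEquivalence
          ; reflexive     = λ { {x} refl → to T-∀ᶠ reflexive x }
          ; trans         = λ {x} {y} {z} x≤y y≤z →
              to T-⇒ (to T-∀ᶠ (to T-∀ᶠ (to T-∀ᶠ transitive x) y) z) (from (T-∧ {R x y}) (x≤y , y≤z))
          }
        ; antisym = λ {x} {y} x≤y y≤x →
            to T-== (to T-⇒ (to T-∀ᶠ (to T-∀ᶠ antisymmetric x) y) (from (T-∧ {R x y}) (x≤y , y≤x)))
        }

    T-isJoin : {x y z : Fin n} → T (isJoin R x y z) → IsJoin x y z
    T-isJoin {x} {y} {z} h =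
      let (y≤x , rest) = to (T-∧ {R y x}) h ; (z≤x , least) = to (T-∧ {R z x}) rest in
      y≤x , z≤x , λ u y≤u z≤u → to T-⇒ (to T-∀ᶠ least u) (from (T-∧ {R y u}) (y≤u , z≤u))

    T-joinReducible : {x : Fin n} → T (joinReducible R x) → ∃₂ λ y z → y ≢ x × z ≢ x × IsJoin x y z
    T-joinReducible {x} h =
      let (y , h′) = to T-∃ᶠ h ; (z , h″) = to T-∃ᶠ h′
          (y≠x , rest) = to (T-∧ {not (y == x)}) h″ ; (z≠x , j) = to (T-∧ {not (z == x)}) rest
      in y , z , to T-not y≠x ∘ from T-== , to T-not z≠x ∘ from T-== , T-isJoin j

    T-<[] : {x y : Fin n} → T (x <[ R ] y) ⇔ x ⊏ y
    T-<[] {x} {y} = mk⇔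
      (λ h → let (x≤y , x≠y) = to (T-∧ {R x y}) h in x≤y , to T-not x≠y ∘ from T-==)
      (λ (x≤y , x≢y) → from (T-∧ {R x y}) (x≤y , from T-not (x≢y ∘ to T-==)))

    T-covers : {x y : Fin n} → T (covers R x y) ⇔ (x ⊏ y × ¬ ∃ λ z → x ⊏ z × z ⊏ y)
    T-covers {x} {y} = mk⇔
      (λ h → let (x<y , none) = to (T-∧ {x <[ R ] y}) h in
        to T-<[] x<y , λ (z , x⊏z , z⊏y) →
          to T-not none (from T-∃ᶠ (z , from (T-∧ {x <[ R ] z}) (from T-<[] x⊏z , from T-<[] z⊏y))))
      (λ (x⊏y , none) → from (T-∧ {x <[ R ] y}) (from T-<[] x⊏y , from T-not λ h →
        let (z , between) = to T-∃ᶠ h ; (x<z , z<y) = to (T-∧ {x <[ R ] z}) between in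
        none (z , to T-<[] x<z , to T-<[] z<y)))

  T-isLattice : (R : Rel n) → T (isLattice R) →
    IsPartialOrder _≡_ ⟦ R ⟧ × (∀ y z → ∃ λ x → IsJoin R x y z) × (∀ y z → ∃ λ x → IsJoin (flip R) x y z)
  T-isLattice R h =
    let (po , bounds) = to (T-∧ {isPartialOrder R}) h
        bound y z = to (T-∧ {∃ᶠ λ x → isJoin R x y z}) (to T-∀ᶠ (to T-∀ᶠ bounds y) z)
    in T-isPartialOrder R po
     , (λ y z → let (x , j) = to T-∃ᶠ (proj₁ (bound y z)) in x , T-isJoin R j)
     , (λ y z → let (x , j) = to T-∃ᶠ (proj₂ (bound y z)) in x , T-isJoin (flip R) j)

-- Upper covers and the number of reducible elements

module _ {n : ℕ} where

  greatest-element : {_≤_ : Fin n → Fin n → Set} → Transitive _≤_ → (∀ y z → ∃ λ x → y ≤ x × z ≤ x) →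
                     Fin n → ∃ λ t → ∀ x → x ≤ t
  greatest-element {_≤_} transitive upper x₀ =
    let (t , below) = bound (allFin n) in t , λ x → All.lookup below (∈-allFin x)
    where
    bound : ∀ xs → ∃ λ t → All (_≤ t) xs
    bound []       = x₀ , []
    bound (y ∷ ys) =
      let (t , below) = bound ys ; (t′ , y≤t′ , t≤t′) = upper y t in
      t′ , y≤t′ ∷ All.map (λ x≤t → transitive x≤t t≤t′) below

  module _ {R : Rel n} (po : IsPartialOrder _≡_ ⟦ R ⟧) where

    private
      module PO = IsPartialOrder po

    cover-below : ∀ {x t} → _⊏_ R x t → ∃ λ y → T (covers R x y) × ⟦ R ⟧ y t
    cover-below {x} {t} = search (po-wellFounded po t)
      where
      search : ∀ {t} → Acc (_⊏_ R) t → _⊏_ R x t → ∃ λ y → T (covers R x y) × ⟦ R ⟧ y t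
      search {t} (acc below) x⊏t with T? (∃ᶠ λ z → (x <[ R ] z) ∧ (z <[ R ] t))
      ... | yes between =
        let (z , x<z∧z<t) = to T-∃ᶠ between
            (x<z , z<t) = to (T-∧ {x <[ R ] z}) x<z∧z<t
            z⊏t = to (T-<[] R) z<t
            (y , x⋖y , y≤z) = search (below z⊏t) (to (T-<[] R) x<z)
        in y , x⋖y , PO.trans y≤z (proj₁ z⊏t)
      ... | no none =
        let x⋖t = from (T-covers R) (x⊏t , λ (z , x⊏z , z⊏t) →
                    none (from T-∃ᶠ (z , from (T-∧ {x <[ R ] z}) (from (T-<[] R) x⊏z , from (T-<[] R) z⊏t))))
        in t , x⋖t , PO.refl

    module _ {top : Fin n} (top-greatest : ∀ x → ⟦ R ⟧ x top) where

      -- meetReducible R is joinReducible (flip R) by definition, as isMeet is isJoin of the flipped order.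
      meetReducible⇒≢top : ∀ {x} → T (meetReducible R x) → x ≢ top
      meetReducible⇒≢top h refl =
        let (y , _ , y≢x , _ , x≤y , _) = T-joinReducible (flip R) h in
        y≢x (PO.antisym (top-greatest y) x≤y)

      two-upper-covers : ∀ {x} → T (meetReducible R x) → 2 ≤ count (covers R x)
      two-upper-covers {x} h =
        let (y , z , y≢x , z≢x , x≤y , x≤z , below-both⇒below-x) = T-joinReducible (flip R) h
            (y′ , x⋖y′ , y′≤y) = cover-below (x≤y , y≢x ∘ sym)
            (z′ , x⋖z′ , z′≤z) = cover-below (x≤z , z≢x ∘ sym)
            ((x≤y′ , x≢y′) , _) = to (T-covers R) x⋖y′
            y′≢z′ : y′ ≢ z′
            y′≢z′ y′≡z′ = x≢y′ (PO.antisym x≤y′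
              (below-both⇒below-x y′ y′≤y (subst (λ w → ⟦ R ⟧ w z) (sym y′≡z′) z′≤z)))
        in count-pair x⋖y′ x⋖z′ y′≢z′

      upper-cover : ∀ {x} → x ≢ top → 1 ≤ count (covers R x)
      upper-cover {x} x≢top =
        count-witness {p = covers R x} (proj₁ (proj₂ (cover-below (top-greatest x , x≢top))))

      upper-covers-bound : ∀ x → 1 + indicator (meetReducible R x) ≤ indicator (x == top) + count (covers R x)
      upper-covers-bound x with x == top in x=top | meetReducible R x in x-mr
      ... | true  | true  = contradiction (to T-== (from T-≡ x=top)) (meetReducible⇒≢top (from T-≡ x-mr))
      ... | true  | false = s≤s z≤n
      ... | false | true  = two-upper-covers (from T-≡ x-mr)
      ... | false | false = upper-cover (λ x≡top → subst T x=top (from T-== x≡top))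

      meetReducibles-bound : n + count (meetReducible R) ≤ 1 + numCovers R
      meetReducibles-bound = begin
        n + count (meetReducible R)
          ≡⟨ cong₂ _+_ (sym (∑-const-1 n)) (count≡∑ (meetReducible R)) ⟩
        ∑[ x < n ] 1 + ∑[ x < n ] indicator (meetReducible R x)
          ≡⟨ ∑-distrib-+ (λ _ → 1) (indicator ∘ meetReducible R) ⟨
        ∑[ x < n ] (1 + indicator (meetReducible R x))
          ≤⟨ ∑-mono-≤ upper-covers-bound ⟩
        ∑[ x < n ] (indicator (x == top) + count (covers R x))
          ≡⟨ ∑-distrib-+ (λ x → indicator (x == top)) (count ∘ covers R) ⟩
        ∑[ x < n ] indicator (x == top) + ∑[ x < n ] count (covers R x)
          ≡⟨ cong₂ _+_ (trans (sym (count-== top)) (count≡∑ (_== top))) (sum-map-allFin (count ∘ covers R)) ⟨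
        1 + numCovers R ∎
        where open ≤-Reasoning

  covers-flip : (R : Rel n) (x y : Fin n) → covers (flip R) x y ≡ covers R y x
  covers-flip R x y = T-⇔→≡ (mk⇔ (reverse R) (reverse (flip R)))
    where
    reverse : ∀ (S : Rel n) {x y} → T (covers (flip S) x y) → T (covers S y x)
    reverse S h =
      let ((y≤x , x≢y) , none) = to (T-covers (flip S)) h in
      from (T-covers S) ((y≤x , x≢y ∘ sym) , λ (z , (y≤z , y≢z) , (z≤x , z≢x)) →
        none (z , (z≤x , z≢x ∘ sym) , (y≤z , y≢z ∘ sym)))

  numCovers≡∑∑ : (R : Rel n) → numCovers R ≡ ∑[ x < n ] ∑[ y < n ] indicator (covers R x y)
  numCovers≡∑∑ R = trans (sum-map-allFin (count ∘ covers R)) (sum-cong-≗ (count≡∑ ∘ covers R))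

  numCovers-flip : (R : Rel n) → numCovers (flip R) ≡ numCovers R
  numCovers-flip R = begin
    numCovers (flip R)
      ≡⟨ numCovers≡∑∑ (flip R) ⟩
    ∑[ x < n ] ∑[ y < n ] indicator (covers (flip R) x y)
      ≡⟨ sum-cong-≗ (λ x → sum-cong-≗ (cong indicator ∘ covers-flip R x)) ⟩
    ∑[ x < n ] ∑[ y < n ] indicator (covers R y x)
      ≡⟨ ∑-comm (λ x y → indicator (covers R y x)) ⟩
    ∑[ y < n ] ∑[ x < n ] indicator (covers R y x)
      ≡⟨ numCovers≡∑∑ R ⟨
    numCovers R ∎
    where open ≡-Reasoning

  joinReducibles-bound : {R : Rel n} → IsPartialOrder _≡_ ⟦ R ⟧ →
                         {bottom : Fin n} → (∀ x → ⟦ R ⟧ bottom x) →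
                         n + count (joinReducible R) ≤ 1 + numCovers R
  joinReducibles-bound {R} po bottom-least =
    subst (λ m → n + count (joinReducible R) ≤ 1 + m) (numCovers-flip R)
      (meetReducibles-bound (Flip.isPartialOrder po) bottom-least)

module _ {n : ℕ} where

  record Block (R : Rel n) : Set where
    field
      partialOrder         : IsPartialOrder _≡_ ⟦ R ⟧
      top bottom           : Fin n
      top-greatest         : ∀ x → ⟦ R ⟧ x top
      bottom-least         : ∀ x → ⟦ R ⟧ bottom x
      top-joinReducible    : T (joinReducible R top)
      bottom-meetReducible : T (meetReducible R bottom)

  -- The inhabitant is needed: over Fin 0 the Boolean conditions of isBlock hold vacuously.
  T-isBlock : (R : Rel n) → T (isBlock R) → Fin n → Block R
  T-isBlock R h x₀ =
    let (lattice , ends)        = to (T-∧ {isLattice R}) h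
        (tops , bottoms)        = to (T-∧ {∀ᶠ λ t → not (isGreatest R t) ∨ joinReducible R t}) ends
        (po , joins , meets)    = T-isLattice R lattice
        upper-bound : ∀ {S} → (∀ y z → ∃ λ x → IsJoin S x y z) → ∀ y z → ∃ λ x → ⟦ S ⟧ y x × ⟦ S ⟧ z x
        upper-bound j y z       = map₂ (λ (y≤x , z≤x , _) → y≤x , z≤x) (j y z)
        (top , top-greatest)    = greatest-element (IsPartialOrder.trans po) (upper-bound joins) x₀
        (bottom , bottom-least) = greatest-element (flip (IsPartialOrder.trans po)) (upper-bound meets) x₀
    in record
      { partialOrder         = po
      ; top                  = top
      ; bottom               = bottom
      ; top-greatest         = top-greatest
      ; bottom-least         = bottom-least
      ; top-joinReducible    = to T-⇒ (to T-∀ᶠ tops top) (from T-∀ᶠ top-greatest)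
      ; bottom-meetReducible = to T-⇒ (to T-∀ᶠ bottoms bottom) (from T-∀ᶠ bottom-least)
      }

  module _ {R : Rel n} (B : Block R) where
    open Block B
    private
      module PO = IsPartialOrder partialOrder

    top≢bottom : top ≢ bottom
    top≢bottom top≡bottom =
      let (y , _ , y≢top , _ , y≤top , _) = T-joinReducible R top-joinReducible in
      y≢top (PO.antisym y≤top (subst (λ b → ⟦ R ⟧ b y) (sym top≡bottom) (bottom-least y)))

    2≤numReducible : 2 ≤ numReducible R
    2≤numReducible = count-pair {p = reducible R}
      (from T-∨ (inj₁ top-joinReducible)) (from T-∨ (inj₂ bottom-meetReducible)) top≢bottom

    numReducible≤2*nullity : ∀ {k} → hasNullity R k → numReducible R ≤ 2 * k
    numReducible≤2*nullity {k} nullity = begin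
      numReducible R
        ≤⟨ count-∨ (joinReducible R) (meetReducible R) ⟩
      count (joinReducible R) + count (meetReducible R)
        ≤⟨ +-mono-≤ (at-most-nullity (joinReducibles-bound partialOrder bottom-least))
                    (at-most-nullity (meetReducibles-bound partialOrder top-greatest)) ⟩
      k + k
        ≡⟨ cong (k +_) (+-identityʳ k) ⟨
      2 * k ∎
      where
      open ≤-Reasoning
      at-most-nullity : ∀ {c} → n + c ≤ 1 + numCovers R → c ≤ k
      at-most-nullity {c} bound =
        +-cancelˡ-≤ n c k (≤-trans bound (≤-reflexive (trans (+-comm 1 (numCovers R)) nullity)))

-- Isomorphism invariance

module _ {n : ℕ} (π : Fin n ↔ Fin n) where

  private
    σ σ⁻¹ : Fin n → Fin n
    σ   = Inverse.to π
    σ⁻¹ = Inverse.from π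

  ∃ᶠ-permute : {p q : Fin n → Bool} → (∀ x → p x ≡ q (σ x)) → ∃ᶠ p ≡ ∃ᶠ q
  ∃ᶠ-permute {p} {q} p≡q∘σ = T-⇔→≡ (mk⇔
    (λ h → let (x , px) = to T-∃ᶠ h in from T-∃ᶠ (σ x , subst T (p≡q∘σ x) px))
    (λ h → let (y , qy) = to T-∃ᶠ h in
      from T-∃ᶠ (σ⁻¹ y , subst T (sym (p≡q∘σ (σ⁻¹ y)))
                           (subst (T ∘ q) (sym (Inverse.strictlyInverseˡ π y)) qy))))

  ∀ᶠ-permute : {p q : Fin n → Bool} → (∀ x → p x ≡ q (σ x)) → ∀ᶠ p ≡ ∀ᶠ q
  ∀ᶠ-permute {p} {q} p≡q∘σ = T-⇔→≡ (mk⇔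
    (λ h → from T-∀ᶠ λ y →
      subst (T ∘ q) (Inverse.strictlyInverseˡ π y) (subst T (p≡q∘σ (σ⁻¹ y)) (to T-∀ᶠ h (σ⁻¹ y))))
    (λ h → from T-∀ᶠ λ x → subst T (sym (p≡q∘σ x)) (to T-∀ᶠ h (σ x))))

  ==-permute : ∀ x y → (x == y) ≡ (σ x == σ y)
  ==-permute x y = T-⇔→≡ (mk⇔ (from T-== ∘ cong σ ∘ to T-==) (from T-== ∘ σ-injective ∘ to T-==))
    where
    σ-injective : ∀ {x y} → σ x ≡ σ y → x ≡ y
    σ-injective {x} {y} σx≡σy =
      trans (sym (Inverse.strictlyInverseʳ π x)) (trans (cong σ⁻¹ σx≡σy) (Inverse.strictlyInverseʳ π y))

  module _ {R S : Rel n} (R≡S∘σ : ∀ x y → R x y ≡ S (σ x) (σ y)) where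

    isJoin-permute : ∀ x y z → isJoin R x y z ≡ isJoin S (σ x) (σ y) (σ z)
    isJoin-permute x y z = cong₂ _∧_ (R≡S∘σ y x) (cong₂ _∧_ (R≡S∘σ z x) (∀ᶠ-permute λ u →
      cong₂ (λ a b → not a ∨ b) (cong₂ _∧_ (R≡S∘σ y u) (R≡S∘σ z u)) (R≡S∘σ x u)))

    joinReducible-permute : ∀ x → joinReducible R x ≡ joinReducible S (σ x)
    joinReducible-permute x = ∃ᶠ-permute λ y → ∃ᶠ-permute λ z →
      cong₂ _∧_ (cong not (==-permute y x)) (cong₂ _∧_ (cong not (==-permute z x)) (isJoin-permute x y z))

  reducible-permute : {R S : Rel n} → (∀ x y → R x y ≡ S (σ x) (σ y)) →
                      ∀ x → reducible R x ≡ reducible S (σ x)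
  reducible-permute {R} {S} R≡S∘σ x =
    cong₂ _∨_ (joinReducible-permute {R} {S} R≡S∘σ x)
              (joinReducible-permute {flip R} {flip S} (flip R≡S∘σ) x)

numReducible-iso : ∀ {n} {R S : Rel n} → Iso R S → numReducible R ≡ numReducible S
numReducible-iso {R = R} {S} (π , R≡S∘π) = count-permute π (reducible-permute π {R} {S} R≡S∘π)

-- Counting isomorphism classes

⊎↔∃ : ∀ {m} {P : Fin (suc m) → Set} → (P zero ⊎ ∃ (P ∘ suc)) ↔ ∃ P
⊎↔∃ {P = P} = mk↔ₛ′ fromSum ∃-toSum fromSum∘toSum toSum∘fromSum
  where
  fromSum : (P zero ⊎ ∃ (P ∘ suc)) → ∃ P
  fromSum = [ ∃-here , ∃-there ]
  fromSum∘toSum : ∀ p → fromSum (∃-toSum p) ≡ p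
  fromSum∘toSum (zero  , _) = refl
  fromSum∘toSum (suc _ , _) = refl
  toSum∘fromSum : ∀ s → ∃-toSum (fromSum s) ≡ s
  toSum∘fromSum (inj₁ _) = refl
  toSum∘fromSum (inj₂ _) = refl

Fin-sum-applyUpTo : ∀ L (g : ℕ → ℕ) → Fin (sum (applyUpTo g L)) ↔ Σ (Fin L) (Fin ∘ g ∘ toℕ)
Fin-sum-applyUpTo zero    g = mk↔ₛ′ (λ ()) (λ ()) (λ ()) (λ ())
Fin-sum-applyUpTo (suc L) g = ⊎↔∃ ↔-∘ ((↔-id _ ⊎-↔ Fin-sum-applyUpTo L (g ∘ suc)) ↔-∘ +↔⊎)

module _ {n : ℕ} where

  Iso-trans : {R S U : Rel n} → Iso R S → Iso S U → Iso R U
  Iso-trans (π , R≡S∘π) (ρ , S≡U∘ρ) = ρ ↔-∘ π , λ x y → trans (R≡S∘π x y) (S≡U∘ρ _ _)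

  -- NumIsoClasses P N unfolds to Σ (Fin N → Rel n) (Classifies P).
  Classifies : {I : Set} → (Rel n → Set) → (I → Rel n) → Set
  Classifies P rep =
    (∀ i → P (rep i)) × (∀ i j → Iso (rep i) (rep j) → i ≡ j) × (∀ R → P R → ∃ λ i → Iso R (rep i))

  module _ {P : Rel n → Set} {I J : Set} {rep : I → Rel n} {rep′ : J → Rel n} where

    reclassify : Classifies P rep → Classifies P rep′ → I → J
    reclassify (P-rep , _ , _) (_ , _ , classify′) i = proj₁ (classify′ (rep i) (P-rep i))

    reclassify-iso : (c : Classifies P rep) (c′ : Classifies P rep′) →
                     ∀ i → Iso (rep i) (rep′ (reclassify c c′ i))
    reclassify-iso (P-rep , _ , _) (_ , _ , classify′) i = proj₂ (classify′ (rep i) (P-rep i))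

  reclassify-inverse : ∀ {P : Rel n → Set} {I J : Set} {rep : I → Rel n} {rep′ : J → Rel n}
    (c : Classifies P rep) (c′ : Classifies P rep′) → ∀ j → reclassify c c′ (reclassify c′ c j) ≡ j
  reclassify-inverse {I = I} {J} {rep′ = rep′} c c′@(_ , injective′ , _) j =
    sym (injective′ j j′ (Iso-trans {U = rep′ j′} (reclassify-iso c′ c j) (reclassify-iso c c′ i)))
    where
    i : I
    i = reclassify c′ c j
    j′ : J
    j′ = reclassify c c′ i

  classification-↔ : ∀ {P : Rel n → Set} {I J : Set} {rep : I → Rel n} {rep′ : J → Rel n} →
                     Classifies P rep → Classifies P rep′ → I ↔ J
  classification-↔ c c′ =
    mk↔ₛ′ (reclassify c c′) (reclassify c′ c) (reclassify-inverse c c′) (reclassify-inverse c′ c)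

  Classifies-⇔ : ∀ {P Q : Rel n → Set} {I : Set} {rep : I → Rel n} →
                 (∀ R → P R ⇔ Q R) → Classifies P rep → Classifies Q rep
  Classifies-⇔ P⇔Q (P-rep , injective , classify) =
    (λ i → to (P⇔Q _) (P-rep i)) , injective , λ R QR → classify R (from (P⇔Q R) QR)

  Classifies-Σ : ∀ {I : Set} {J : I → Set} {Q : I → Rel n → Set} {rep : ∀ i → J i → Rel n} →
                 (∀ {i i′ R S} → Q i R → Q i′ S → Iso R S → i ≡ i′) →
                 (∀ i → Classifies (Q i) (rep i)) →
                 Classifies (λ R → ∃ λ i → Q i R) (uncurry rep)
  Classifies-Σ {Q = Q} {rep} disjoint classes = Q-rep , injective , classify
    where
    Q-rep : ∀ ij → ∃ λ i → Q i (uncurry rep ij)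
    Q-rep (i , j) = i , proj₁ (classes i) j
    injective : ∀ ij ij′ → Iso (uncurry rep ij) (uncurry rep ij′) → ij ≡ ij′
    injective (i , j) (i′ , j′) iso with disjoint (proj₁ (classes i) j) (proj₁ (classes i′) j′) iso
    ... | refl = cong (i ,_) (proj₁ (proj₂ (classes i)) j j′ iso)
    classify : ∀ R → (∃ λ i → Q i R) → ∃ λ ij → Iso R (uncurry rep ij)
    classify R (i , QiR) = let (j , R≅repij) = proj₂ (proj₂ (classes i)) R QiR in (i , j) , R≅repij

m∸2<n∸1 : ∀ {m n} → 2 ≤ m → m ≤ n → m ∸ 2 < n ∸ 1
m∸2<n∸1 {suc (suc m)} {suc n} (s≤s (s≤s _)) (s≤s m+1≤n) = m+1≤n

module _ {n : ℕ} {k : ℕ} where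

  numReducible-range : {R : Rel n} → InB k R → Fin n → 2 ≤ numReducible R × numReducible R ≤ 2 * k
  numReducible-range {R} (block , nullity) x₀ =
    let B = T-isBlock R (proj₁ (to (T-∧ {isBlock R}) block)) x₀ in
    2≤numReducible B , numReducible≤2*nullity B nullity

  InB⇔∃InBr : Fin n → ∀ R → InB k R ⇔ ∃ λ (i : Fin (2 * k ∸ 1)) → InBr k (2 + toℕ i) R
  InB⇔∃InBr x₀ R = mk⇔
    (λ inB → let (2≤r , r≤2k) = numReducible-range inB x₀ ; r∸2<L = m∸2<n∸1 2≤r r≤2k in
      fromℕ< r∸2<L , inB , sym (trans (cong (2 +_) (toℕ-fromℕ< r∸2<L)) (m+[n∸m]≡n 2≤r)))
    (λ (_ , inB , _) → inB)

  InBr-disjoint : ∀ {i j : Fin (2 * k ∸ 1)} {R S : Rel n} →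
                  InBr k (2 + toℕ i) R → InBr k (2 + toℕ j) S → Iso R S → i ≡ j
  InBr-disjoint {R = R} {S} (_ , rR) (_ , rS) R≅S =
    toℕ-injective (+-cancelˡ-≡ 2 _ _ (trans (sym rR) (trans (numReducible-iso {R = R} {S} R≅S) rS)))

mainTheorem6 : (k n : ℕ) → 1 ≤ k → k + 3 ≤ n →
    (N : ℕ) → NumIsoClasses {n} (InB k) N →
    (Nr : ℕ → ℕ) → (∀ r → NumIsoClasses {n} (InBr k r) (Nr r)) →
    N ≡ sum (applyUpTo (λ i → Nr (2 + i)) (2 * k ∸ 1))
mainTheorem6 k n _ k+3≤n N (_ , blocks) Nr classes =
  ↔⇒≡ (↔-sym (Fin-sum-applyUpTo (2 * k ∸ 1) (λ i → Nr (2 + i)))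
       ↔-∘ classification-↔ blocks blocks-by-reducibles)
  where
  x₀ : Fin n
  x₀ = fromℕ< (≤-trans (s≤s z≤n) (≤-trans (m≤n+m 3 k) k+3≤n))
  blocks-by-reducibles : Classifies (InB k) (uncurry λ (i : Fin (2 * k ∸ 1)) → proj₁ (classes (2 + toℕ i)))
  blocks-by-reducibles =
    Classifies-⇔ (⇔-sym ∘ InB⇔∃InBr x₀) (Classifies-Σ InBr-disjoint (proj₂ ∘ classes ∘ (2 +_) ∘ toℕ))
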